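{- Let $k\ge2$, $2\le i\le k$ and $n\ge2$ be integers and $\iota=\sqrt{ -1}$. For $\lambda\in\{1,2\}$ and $m\ge1$ let $Q_{k,m}=(q_{st})$ be the $m\times m$ matrix with $q_{st}=\iota^{|s-t|}$ if $-1\le s-t<k$ and $s\ne t$, $q_{ss}=\lambda$, $q_{st}=0$ otherwise, and let $Q_{k,n}^{i}$ be the $n\times n$ matrix whose first row is $(1,\iota,0,\dots,0)$, whose first column has entry $\iota^{r-1}$ in row $r$ for $1\le r\le\min(n,k-i+1)$ and $0$ in the remaining rows, and whose submatrix obtained by deleting the first row and column is $Q_{k,n-1}$. Then $\det(Q_{k,n}^{i})=f_{k,n}^{i}$ when $\lambda=1$, and $\det(Q_{k,n}^{i})=p_{k,n}^{i}$ when $\lambda=2$, where $f$ and $p$ are as in the context.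
   Context: For a positive integer $k$ and $1\le i\le k$, the sequences $(f_{k,n}^{i})_{n\ge1-k}$ (generalized order-$k$ Fibonacci) and $(p_{k,n}^{i})_{n\ge1-k}$ (generalized order-$k$ Pell) have initial values equal to $1$ if $i=1-n$ and $0$ otherwise, for $1-k\le n\le 0$, and satisfy for $n\ge1$ the recurrences $f_{k,n}^{i}=f_{k,n-1}^{i}+f_{k,n-2}^{i}+\cdots+f_{k,n-k}^{i}$ and $p_{k,n}^{i}=2p_{k,n-1}^{i}+p_{k,n-2}^{i}+\cdots+p_{k,n-k}^{i}$. -}

module Defs where

open import Data.Nat as ℕ using (ℕ; zero; suc; _∸_; _≤?_; _<?_)
open import Data.Nat.Properties using () renaming (_≟_ to _≟ℕ_)
open import Data.Integer as ℤ using (ℤ)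
open import Data.Fin using (Fin; zero; suc; toℕ)
open import Data.List using (List; []; _∷_; take; drop)
open import Data.Nat.ListAction using (sum)
open import Data.Bool using (if_then_else_; _∧_)
open import Relation.Nullary.Decidable using (⌊_⌋)

-- Gaussian integers ℤ[ι] (all matrix entries lie here)

record ℤ[ι] : Set where
  constructor gauss
  field
    re : ℤ
    im : ℤ
open ℤ[ι] public

infixl 6 _⊕_
infixl 7 _⊗_

_⊕_ : ℤ[ι] → ℤ[ι] → ℤ[ι]
(gauss a b) ⊕ (gauss c d) = gauss (a ℤ.+ c) (b ℤ.+ d)

_⊗_ : ℤ[ι] → ℤ[ι] → ℤ[ι]
(gauss a b) ⊗ (gauss c d) = gauss (a ℤ.* c ℤ.- b ℤ.* d) (a ℤ.* d ℤ.+ b ℤ.* c)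

⊖_ : ℤ[ι] → ℤ[ι]
⊖ (gauss a b) = gauss (ℤ.- a) (ℤ.- b)

fromℕ : ℕ → ℤ[ι]
fromℕ n = gauss (ℤ.+ n) (ℤ.+ 0)

𝟘 𝟙 ι : ℤ[ι]
𝟘 = fromℕ 0
𝟙 = fromℕ 1
ι = gauss (ℤ.+ 0) (ℤ.+ 1)

ι^ : ℕ → ℤ[ι]
ι^ zero = 𝟙
ι^ (suc n) = ι ⊗ ι^ n

ΣFin : ∀ {m} → (Fin m → ℤ[ι]) → ℤ[ι]
ΣFin {zero} f = 𝟘
ΣFin {suc m} f = f zero ⊕ ΣFin (λ j → f (suc j))

signed : ℕ → ℤ[ι] → ℤ[ι]
signed zero x = x
signed (suc zero) x = ⊖ x
signed (suc (suc j)) x = signed j x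

minor : ∀ {m} → Fin (suc m) → (Fin (suc m) → Fin (suc m) → ℤ[ι]) → Fin m → Fin m → ℤ[ι]
minor j A r c = A (suc r) (Data.Fin.punchIn j c)

det : ∀ m → (Fin m → Fin m → ℤ[ι]) → ℤ[ι]
det zero A = 𝟙
det (suc m) A = ΣFin (λ j → signed (toℕ j) (A zero j ⊗ det m (minor j A)))

-- The matrices.  Indices are 0-based here (s, t, r, c); differences
-- s - t are the same as for the paper's 1-based indices.

Qentry : ℤ[ι] → ℕ → ℕ → ℕ → ℤ[ι]
Qentry λ' k s t =
  if ⌊ s ≟ℕ t ⌋ then λ'
  else if ⌊ suc s ≟ℕ t ⌋ then ι^ 1
  else if ⌊ t <? s ⌋ ∧ ⌊ s ∸ t <? k ⌋ then ι^ (s ∸ t)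
  else 𝟘

Q : ℤ[ι] → (k m : ℕ) → Fin m → Fin m → ℤ[ι]
Q λ' k m s t = Qentry λ' k (toℕ s) (toℕ t)

Qi : ℤ[ι] → (k i n : ℕ) → Fin n → Fin n → ℤ[ι]
Qi λ' k i (suc m) zero zero = 𝟙
Qi λ' k i (suc m) zero (suc zero) = ι
Qi λ' k i (suc m) zero (suc (suc _)) = 𝟘
-- 0-based row r' = toℕ (suc r), i.e. 1-based row r' + 1 ≤ k - i + 1
Qi λ' k i (suc m) (suc r) zero =
  if ⌊ suc (toℕ r) ≤? k ∸ i ⌋ then ι^ (suc (toℕ r)) else 𝟘
Qi λ' k i (suc m) (suc r) (suc c) = Q λ' k m r c

-- Generalized order-k sequences with leading coefficient c
-- (c = 1: Fibonacci f^i_{k,n}; c = 2: Pell p^i_{k,n}).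
-- We use the shifted index j = n + k - 1 ≥ 0 (n ≥ 1 - k).
-- history c k i j = [a_j, a_{j-1}, …, a_0]  where a_j = g^i_{k, j-(k-1)}.

rec : (c k : ℕ) → List ℕ → ℕ
rec c k [] = 0
rec c k (x ∷ rest) = c ℕ.* x ℕ.+ sum (take (k ∸ 1) rest)

-- for j < k (i.e. n ≤ 0): 1 iff i = 1 - n (i.e. i + j = k), else 0;
-- for j ≥ k: c·a_{j-1} + a_{j-2} + … + a_{j-k}
step : (c k i j : ℕ) → List ℕ → ℕ
step c k i j prev =
  if ⌊ j <? k ⌋ then (if ⌊ i ℕ.+ j ≟ℕ k ⌋ then 1 else 0) else rec c k prev

history : (c k i : ℕ) → ℕ → List ℕ
history c k i zero = step c k i 0 [] ∷ []
history c k i (suc j) = step c k i (suc j) (history c k i j) ∷ history c k i j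

headOr0 : List ℕ → ℕ
headOr0 [] = 0
headOr0 (x ∷ _) = x

genSeq : (c k i n : ℕ) → ℕ
genSeq c k i n = headOr0 (history c k i (n ℕ.+ (k ∸ 1)))

fib pell : (k i n : ℕ) → ℕ
fib = genSeq 1
pell = genSeq 2

module Submission where

-- Let D_m(v) be the determinant of Q_{k,m+1} with its first column replaced by v. Its first row is
-- (v₀, ι, 0, …, 0), so D_m(v) = v₀ det Q_{k,m} − ι D_{m-1}(v₁, v₂, …), and because −ι·ι = 1 a column
-- v_t = ι^t b_t gives D_m(v) = Σ_{t ≤ m} b_t det Q_{k,m-t}. Both Q_{k,m+1} and Q^i_{k,m+1} are of the form
-- D_m(v), with b_t = [t < k] (but b₀ = λ) and b_t = [t ≤ k − i] respectively.
-- On the sequence side the recurrence itself gives the first convolution for g^1, whence det Q_{k,m} = g^1_m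
-- by strong induction. For 2 ≤ i ≤ k, g^i_{n+1} = g^1_n + g^{i+1}_n, since both sides solve the recurrence
-- and have the same k initial values; as g^{k+1} = 0 this telescopes to g^i_{n+1} = Σ_{t ≤ k-i} g^1_{n-t},
-- which is the second convolution.

open import Defs
open import Data.Nat using (ℕ; _≤_)
open import Data.Product using (_×_)
open import Relation.Binary.PropositionalEquality using (_≡_)

open import Relation.Binary.PropositionalEquality using (_≢_; refl; sym; trans; cong; cong₂; module ≡-Reasoning)

module GaussianIntegerLaws where
  open import Data.Integer using (+_; _+_; _*_; _-_; -_)
  open import Data.Integer.Properties using (+-identityʳ)
  open import Data.Integer.Tactic.RingSolver using (solve-∀)

  ⊕-identityʳ : ∀ x → x ⊕ 𝟘 ≡ x
  ⊕-identityʳ (gauss a b) = cong₂ gauss (+-identityʳ a) (+-identityʳ b)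

  ⊗-identityˡ : ∀ x → 𝟙 ⊗ x ≡ x
  ⊗-identityˡ (gauss a b) = cong₂ gauss (real a b) (imag a b)
    where
    real : ∀ a b → + 1 * a - + 0 * b ≡ a
    real = solve-∀
    imag : ∀ a b → + 1 * b + + 0 * a ≡ b
    imag = solve-∀

  ⊗-identityʳ : ∀ x → x ⊗ 𝟙 ≡ x
  ⊗-identityʳ (gauss a b) = cong₂ gauss (real a b) (imag a b)
    where
    real : ∀ a b → a * + 1 - b * + 0 ≡ a
    real = solve-∀
    imag : ∀ a b → a * + 0 + b * + 1 ≡ b
    imag = solve-∀

  ⊗-zeroˡ : ∀ x → 𝟘 ⊗ x ≡ 𝟘
  ⊗-zeroˡ (gauss a b) = cong₂ gauss (real a b) (imag a b)
    where
    real : ∀ a b → + 0 * a - + 0 * b ≡ + 0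
    real = solve-∀
    imag : ∀ a b → + 0 * b + + 0 * a ≡ + 0
    imag = solve-∀

  ⊗-zeroʳ : ∀ x → x ⊗ 𝟘 ≡ 𝟘
  ⊗-zeroʳ (gauss a b) = cong₂ gauss (real a b) (imag a b)
    where
    real : ∀ a b → a * + 0 - b * + 0 ≡ + 0
    real = solve-∀
    imag : ∀ a b → a * + 0 + b * + 0 ≡ + 0
    imag = solve-∀

  ⊗-comm : ∀ x y → x ⊗ y ≡ y ⊗ x
  ⊗-comm (gauss a b) (gauss c d) = cong₂ gauss (real a b c d) (imag a b c d)
    where
    real : ∀ a b c d → a * c - b * d ≡ c * a - d * b
    real = solve-∀
    imag : ∀ a b c d → a * d + b * c ≡ c * b + d * a
    imag = solve-∀

  ⊗-assoc : ∀ x y z → (x ⊗ y) ⊗ z ≡ x ⊗ (y ⊗ z)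
  ⊗-assoc (gauss a b) (gauss c d) (gauss e f) = cong₂ gauss (real a b c d e f) (imag a b c d e f)
    where
    real : ∀ a b c d e f → (a * c - b * d) * e - (a * d + b * c) * f ≡ a * (c * e - d * f) - b * (c * f + d * e)
    real = solve-∀
    imag : ∀ a b c d e f → (a * c - b * d) * f + (a * d + b * c) * e ≡ a * (c * f + d * e) + b * (c * e - d * f)
    imag = solve-∀

  ⊗-distribˡ-⊕ : ∀ x y z → x ⊗ (y ⊕ z) ≡ x ⊗ y ⊕ x ⊗ z
  ⊗-distribˡ-⊕ (gauss a b) (gauss c d) (gauss e f) = cong₂ gauss (real a b c d e f) (imag a b c d e f)
    where
    real : ∀ a b c d e f → a * (c + e) - b * (d + f) ≡ (a * c - b * d) + (a * e - b * f)
    real = solve-∀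
    imag : ∀ a b c d e f → a * (d + f) + b * (c + e) ≡ (a * d + b * c) + (a * f + b * e)
    imag = solve-∀

  ι⊗ι⊗-neg : ∀ x → ⊖ (ι ⊗ (ι ⊗ x)) ≡ x
  ι⊗ι⊗-neg (gauss a b) = cong₂ gauss (real a b) (imag a b)
    where
    real : ∀ a b → - (+ 0 * (+ 0 * a - + 1 * b) - + 1 * (+ 0 * b + + 1 * a)) ≡ a
    real = solve-∀
    imag : ∀ a b → - (+ 0 * (+ 0 * b + + 1 * a) + + 1 * (+ 0 * a - + 1 * b)) ≡ b
    imag = solve-∀

open GaussianIntegerLaws

open import Data.Nat using (zero; suc; _+_; _*_; _∸_; _<_; z≤n; s≤s; z<s; s<s; s≤s⁻¹; s<s⁻¹; _≤?_; _<?_)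
open import Data.Nat.Properties
  using (_≟_; suc-injective; ≤-refl; ≤-reflexive; ≤-trans; <⇒≤; <⇒≢; <⇒≱; ≤⇒≯; ≰⇒>;
         m≤n⇒m≤1+n; n≤1+n; m≤m+n; m≤n+m; m≤n⇒m<n∨m≡n; m<n⇒m<1+n; m≢1+m+n; m∸n≤m;
         +-comm; +-assoc; +-suc; +-identityʳ; *-identityˡ; *-zeroʳ; +-∸-assoc; +-∸-comm;
         ∸-monoʳ-≤; m+[n∸m]≡n; m<n+o⇒m∸n<o; +-monoˡ-<)
open import Data.Nat.Induction using (<-rec)
open import Data.Nat.Tactic.RingSolver using (solve-∀)
open import Data.Nat.ListAction using (sum)
import Data.Integer as ℤ
import Data.Integer.Properties as ℤₚ
open import Data.Fin using (Fin; zero; suc; toℕ; punchIn)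
open import Data.List using ([]; take)
open import Data.Bool using (Bool; true; false; if_then_else_)
open import Data.Sum using (inj₁; inj₂)
open import Data.Product using (_,_)
open import Function using (_∘_; _⇔_; mk⇔)
open import Relation.Nullary using (Dec; ¬_)
open import Relation.Nullary.Decidable using (⌊_⌋; yes; no; isYes≗does; dec-true; dec-false; does-⇔)

fromℕ-+ : ∀ m n → fromℕ (m + n) ≡ fromℕ m ⊕ fromℕ n
fromℕ-+ m n = cong₂ gauss (ℤₚ.pos-+ m n) refl

fromℕ-* : ∀ m n → fromℕ (m * n) ≡ fromℕ m ⊗ fromℕ n
fromℕ-* m n =
  cong₂ gauss (trans (ℤₚ.pos-* m n) (sym (ℤₚ.+-identityʳ _)))
              (sym (cong (λ z → z ℤ.+ _) (ℤₚ.*-zeroʳ (ℤ.+ m))))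

ι⊗w⊗ι-neg : ∀ w x → ⊖ (ι ⊗ ((w ⊗ ι) ⊗ x)) ≡ w ⊗ x
ι⊗w⊗ι-neg w x = begin
  ⊖ (ι ⊗ ((w ⊗ ι) ⊗ x)) ≡⟨ cong (λ y → ⊖ (ι ⊗ (y ⊗ x))) (⊗-comm w ι) ⟩
  ⊖ (ι ⊗ ((ι ⊗ w) ⊗ x)) ≡⟨ cong (λ y → ⊖ (ι ⊗ y)) (⊗-assoc ι w x) ⟩
  ⊖ (ι ⊗ (ι ⊗ (w ⊗ x))) ≡⟨ ι⊗ι⊗-neg (w ⊗ x) ⟩
  w ⊗ x                 ∎
  where open ≡-Reasoning

⊗-fromℕ-*-+ : ∀ w b q x → w ⊗ (𝟙 ⊗ fromℕ b) ⊗ fromℕ q ⊕ w ⊗ fromℕ x ≡ w ⊗ fromℕ (b * q + x)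
⊗-fromℕ-*-+ w b q x = begin
  w ⊗ (𝟙 ⊗ fromℕ b) ⊗ fromℕ q ⊕ w ⊗ fromℕ x ≡⟨ cong (λ y → w ⊗ y ⊗ fromℕ q ⊕ w ⊗ fromℕ x) (⊗-identityˡ _) ⟩
  w ⊗ fromℕ b ⊗ fromℕ q ⊕ w ⊗ fromℕ x       ≡⟨ cong (_⊕ w ⊗ fromℕ x) (⊗-assoc w _ _) ⟩
  w ⊗ (fromℕ b ⊗ fromℕ q) ⊕ w ⊗ fromℕ x     ≡⟨ ⊗-distribˡ-⊕ w _ _ ⟨
  w ⊗ (fromℕ b ⊗ fromℕ q ⊕ fromℕ x)         ≡⟨ cong (λ y → w ⊗ (y ⊕ fromℕ x)) (fromℕ-* b q) ⟨
  w ⊗ (fromℕ (b * q) ⊕ fromℕ x)             ≡⟨ cong (w ⊗_) (fromℕ-+ (b * q) x) ⟨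
  w ⊗ fromℕ (b * q + x)                     ∎
  where open ≡-Reasoning

⌊⌋-true : ∀ {a} {A : Set a} (a? : Dec A) → A → ⌊ a? ⌋ ≡ true
⌊⌋-true a? a = trans (isYes≗does a?) (dec-true a? a)

⌊⌋-false : ∀ {a} {A : Set a} (a? : Dec A) → ¬ A → ⌊ a? ⌋ ≡ false
⌊⌋-false a? ¬a = trans (isYes≗does a?) (dec-false a? ¬a)

⌊⌋-⇔ : ∀ {a b} {A : Set a} {B : Set b} → A ⇔ B → (a? : Dec A) (b? : Dec B) → ⌊ a? ⌋ ≡ ⌊ b? ⌋
⌊⌋-⇔ A⇔B a? b? = trans (isYes≗does a?) (trans (does-⇔ A⇔B a? b?) (sym (isYes≗does b?)))

≟-suc : ∀ m n → ⌊ suc m ≟ suc n ⌋ ≡ ⌊ m ≟ n ⌋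
≟-suc m n = ⌊⌋-⇔ (mk⇔ suc-injective (cong suc)) (suc m ≟ suc n) (m ≟ n)

<?-suc : ∀ m n → ⌊ suc m <? suc n ⌋ ≡ ⌊ m <? n ⌋
<?-suc m n = ⌊⌋-⇔ (mk⇔ s<s⁻¹ s<s) (suc m <? suc n) (m <? n)

𝟙[_] : Bool → ℕ
𝟙[ b ] = if b then 1 else 0

δ : ℕ → ℕ → ℕ
δ m n = 𝟙[ ⌊ m ≟ n ⌋ ]

δ-refl : ∀ n → δ n n ≡ 1
δ-refl n = cong 𝟙[_] (⌊⌋-true (n ≟ n) refl)

δ-≢ : ∀ {m n} → m ≢ n → δ m n ≡ 0
δ-≢ {m} {n} m≢n = cong 𝟙[_] (⌊⌋-false (m ≟ n) m≢n)

δ-suc : ∀ m n → δ (suc m) (suc n) ≡ δ m n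
δ-suc m n = cong 𝟙[_] (≟-suc m n)

δ-+-∸ : ∀ {i n} s → i ≤ n → δ (i + s) n ≡ δ s (n ∸ i)
δ-+-∸ s z≤n       = refl
δ-+-∸ s (s≤s i≤n) = trans (δ-suc _ _) (δ-+-∸ s i≤n)

∑< : ℕ → (ℕ → ℕ) → ℕ
∑< zero    f = 0
∑< (suc n) f = f 0 + ∑< n (f ∘ suc)

infixl 10 ∑<
syntax ∑< n (λ s → e) = ∑[ s < n ] e

∑-cong< : ∀ n {f g : ℕ → ℕ} → (∀ s → s < n → f s ≡ g s) → ∑[ s < n ] f s ≡ ∑[ s < n ] g s
∑-cong< zero    _  = refl
∑-cong< (suc n) eq = cong₂ _+_ (eq 0 z<s) (∑-cong< n (λ s s<n → eq (suc s) (s<s s<n)))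

∑-zero : ∀ n {f : ℕ → ℕ} → (∀ s → f s ≡ 0) → ∑[ s < n ] f s ≡ 0
∑-zero zero    _   = refl
∑-zero (suc n) f≡0 = cong₂ _+_ (f≡0 0) (∑-zero n (f≡0 ∘ suc))

∑-weighted-by-1 : ∀ n (w f : ℕ → ℕ) → (∀ s → s < n → w s ≡ 1) →
                  ∑[ s < n ] (w s * f s) ≡ ∑[ s < n ] f s
∑-weighted-by-1 n w f w≡1 = ∑-cong< n (λ s s<n → trans (cong (_* f s) (w≡1 s s<n)) (*-identityˡ (f s)))

∑-distrib-+ : ∀ n (f g : ℕ → ℕ) → ∑[ s < n ] (f s + g s) ≡ ∑[ s < n ] f s + ∑[ s < n ] g s
∑-distrib-+ zero    f g = refl
∑-distrib-+ (suc n) f g =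
  trans (cong (f 0 + g 0 +_) (∑-distrib-+ n (f ∘ suc) (g ∘ suc))) (interchange (f 0) (g 0) _ _)
  where
  interchange : ∀ a b x y → (a + b) + (x + y) ≡ (a + x) + (b + y)
  interchange = solve-∀

∑-snoc : ∀ n (f : ℕ → ℕ) → ∑[ s < suc n ] f s ≡ ∑[ s < n ] f s + f n
∑-snoc zero    f = +-identityʳ (f 0)
∑-snoc (suc n) f = trans (cong (f 0 +_) (∑-snoc n (f ∘ suc))) (sym (+-assoc (f 0) _ _))

∑-reverse : ∀ n (f : ℕ → ℕ) → ∑[ s < n ] f (n ∸ suc s) ≡ ∑[ s < n ] f s
∑-reverse zero    f = refl
∑-reverse (suc n) f = begin
  f n + ∑[ s < n ] f (n ∸ suc s) ≡⟨ cong (f n +_) (∑-reverse n f) ⟩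
  f n + ∑[ s < n ] f s           ≡⟨ +-comm (f n) _ ⟩
  ∑[ s < n ] f s + f n           ≡⟨ ∑-snoc n f ⟨
  ∑[ s < suc n ] f s             ∎
  where open ≡-Reasoning

∑-stable : ∀ {n n'} (f : ℕ → ℕ) → (∀ t → n ≤ t → f t ≡ 0) → n ≤ n' →
           ∑[ t < n' ] f t ≡ ∑[ t < n ] f t
∑-stable {n' = n'} f vanishes z≤n = ∑-zero n' (λ t → vanishes t z≤n)
∑-stable f vanishes (s≤s n≤n')    = cong (f 0 +_) (∑-stable (f ∘ suc) (λ t → vanishes (suc t) ∘ s≤s) n≤n')

∑-δ : ∀ n {t} → t < n → ∑[ s < n ] δ s t ≡ 1
∑-δ (suc n) {zero}  _ = cong₂ _+_ (δ-refl 0) (∑-zero n (λ s → δ-≢ {suc s} {0} λ ()))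
∑-δ (suc n) {suc t} (s<s t<n) =
  cong₂ _+_ (δ-≢ {0} {suc t} λ ()) (trans (∑-cong< n (λ s _ → δ-suc s t)) (∑-δ n t<n))

conv : (ℕ → ℕ) → (ℕ → ℕ) → ℕ → ℕ
conv b q m = ∑[ t < suc m ] (b t * q (m ∸ t))

module LinearRecurrence (c L : ℕ) where

  Recurrent : (ℕ → ℕ) → Set
  Recurrent x = ∀ j → L ≤ j → x (suc j) ≡ c * x j + ∑[ s < L ] x (j ∸ suc s)

  Recurrent-shift : ∀ {x} → Recurrent x → Recurrent (x ∘ suc)
  Recurrent-shift {x} rec j L≤j =
    trans (rec (suc j) (m≤n⇒m≤1+n L≤j))
          (cong (c * x (suc j) +_) (∑-cong< L (λ s s<L → cong x (+-∸-assoc 1 (≤-trans s<L L≤j)))))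

  Recurrent-+ : ∀ {x y} → Recurrent x → Recurrent y → Recurrent (λ j → x j + y j)
  Recurrent-+ {x} {y} rx ry j L≤j = begin
    x (suc j) + y (suc j)         ≡⟨ cong₂ _+_ (rx j L≤j) (ry j L≤j) ⟩
    (c * x j + X) + (c * y j + Y) ≡⟨ collect c (x j) (y j) X Y ⟩
    c * (x j + y j) + (X + Y)     ≡⟨ cong (c * (x j + y j) +_) (∑-distrib-+ L _ _) ⟨
    c * (x j + y j) + ∑[ s < L ] (x (j ∸ suc s) + y (j ∸ suc s)) ∎
    where
    open ≡-Reasoning
    X = ∑[ s < L ] x (j ∸ suc s)
    Y = ∑[ s < L ] y (j ∸ suc s)
    collect : ∀ c u v X Y → (c * u + X) + (c * v + Y) ≡ c * (u + v) + (X + Y)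
    collect = solve-∀

  Recurrent-zero : Recurrent (λ _ → 0)
  Recurrent-zero j _ = sym (cong₂ _+_ (*-zeroʳ c) (∑-zero L (λ _ → refl)))

  Recurrent-unique : ∀ {x y} → Recurrent x → Recurrent y →
                     (∀ j → j ≤ L → x j ≡ y j) → ∀ j → x j ≡ y j
  Recurrent-unique {x} {y} rx ry initial = <-rec _ agree
    where
    open ≡-Reasoning
    agree : ∀ j → (∀ {i} → i < j → x i ≡ y i) → x j ≡ y j
    agree zero    _ = initial 0 z≤n
    agree (suc j) earlier with L ≤? j
    ... | no L≰j  = initial (suc j) (≰⇒> L≰j)
    ... | yes L≤j = begin
      x (suc j)                          ≡⟨ rx j L≤j ⟩
      c * x j + ∑[ s < L ] x (j ∸ suc s) ≡⟨ cong₂ (λ u v → c * u + v) (earlier ≤-refl)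
                                              (∑-cong< L (λ s _ → earlier (s≤s (m∸n≤m j (suc s))))) ⟩
      c * y j + ∑[ s < L ] y (j ∸ suc s) ≡⟨ ry j L≤j ⟨
      y (suc j)                          ∎

module Sequence (c ℓ : ℕ) where

  L k : ℕ
  L = suc ℓ
  k = suc L

  open LinearRecurrence c L

  -- g i j = g^i_{k, j - L}: the sequence reindexed so that its k initial values sit at j = 0, …, L.
  g : ℕ → ℕ → ℕ
  g i j = headOr0 (history c k i j)

  g₁ : ℕ → ℕ
  g₁ n = g 1 (n + L)

  step-initial : ∀ i j prev → j ≤ L → step c k i j prev ≡ δ (i + j) k
  step-initial i j prev j≤L =
    cong (λ b → if b then δ (i + j) k else rec c k prev) (⌊⌋-true (j <? k) (s≤s j≤L))

  g-initial : ∀ i {j} → j ≤ L → g i j ≡ δ (i + j) k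
  g-initial i {zero}  = step-initial i 0 []
  g-initial i {suc j} = step-initial i (suc j) (history c k i j)

  sum-take-history : ∀ i t j → t ≤ suc j → sum (take t (history c k i j)) ≡ ∑[ s < t ] g i (j ∸ s)
  sum-take-history i zero          j       _         = refl
  sum-take-history i (suc zero)    zero    _         = refl
  sum-take-history i (suc (suc t)) zero    (s≤s ())
  sum-take-history i (suc t)       (suc j) (s≤s t≤j) = cong (g i (suc j) +_) (sum-take-history i t j t≤j)

  g-recurrent : ∀ i → Recurrent (g i)
  g-recurrent i zero    ()
  g-recurrent i (suc j) L≤j =
    trans (cong (λ b → if b then δ (i + suc (suc j)) k else rec c k (history c k i (suc j)))
                (⌊⌋-false (suc (suc j) <? k) (≤⇒≯ L≤j ∘ s<s⁻¹)))
          (cong (c * g i (suc j) +_) (sum-take-history i L j L≤j))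

  g₁-leading-zeros : ∀ {x} → x < L → g 1 x ≡ 0
  g₁-leading-zeros x<L = trans (g-initial 1 (<⇒≤ x<L)) (trans (δ-suc _ _) (δ-≢ (<⇒≢ x<L)))

  g-at-k≡1 : ∀ {i} → 2 ≤ i → i ≤ k → g i k ≡ 1
  g-at-k≡1 {i} 2≤i i≤k = begin
    g i (suc L)                              ≡⟨ g-recurrent i L ≤-refl ⟩
    c * g i L + ∑[ s < L ] g i (L ∸ suc s)
      ≡⟨ cong₂ _+_ (cong (c *_) (g-initial i ≤-refl)) (∑-reverse L (g i)) ⟩
    c * δ (i + L) k + ∑[ s < L ] g i s
      ≡⟨ cong₂ (λ u v → c * u + v) (δ-+-∸ L i≤k)
               (∑-cong< L (λ s s<L → trans (g-initial i (<⇒≤ s<L)) (δ-+-∸ s i≤k))) ⟩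
    c * δ L (k ∸ i) + ∑[ s < L ] δ s (k ∸ i)
      ≡⟨ cong₂ (λ u v → c * u + v) (δ-≢ (<⇒≢ k∸i<L ∘ sym)) (∑-δ L k∸i<L) ⟩
    c * 0 + 1                                ≡⟨ cong (_+ 1) (*-zeroʳ c) ⟩
    1                                        ∎
    where
    open ≡-Reasoning
    k∸i<L : k ∸ i < L
    k∸i<L = s≤s (∸-monoʳ-≤ k 2≤i)

  g[k+1]≡0 : ∀ j → g (suc k) j ≡ 0
  g[k+1]≡0 = Recurrent-unique (g-recurrent (suc k)) Recurrent-zero
               (λ j j≤L → trans (g-initial (suc k) j≤L) (δ-≢ (m≢1+m+n k ∘ sym)))

  g-suc-split : ∀ {i} → 2 ≤ i → i ≤ k → ∀ j → g i (suc j) ≡ g 1 j + g (suc i) j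
  g-suc-split {i} 2≤i i≤k =
    Recurrent-unique (Recurrent-shift (g-recurrent i)) (Recurrent-+ (g-recurrent 1) (g-recurrent (suc i))) initial
    where
    open ≡-Reasoning
    initial : ∀ j → j ≤ L → g i (suc j) ≡ g 1 j + g (suc i) j
    initial j j≤L with m≤n⇒m<n∨m≡n j≤L
    ... | inj₂ refl = begin
      g i k               ≡⟨ g-at-k≡1 2≤i i≤k ⟩
      1 + 0               ≡⟨ cong₂ _+_ (trans (g-initial 1 ≤-refl) (δ-refl k))
                                       (trans (g-initial (suc i) ≤-refl) (δ-≢ (<⇒≢ k<1+i+L ∘ sym))) ⟨
      g 1 L + g (suc i) L ∎
      where
      k<1+i+L : k < suc i + L
      k<1+i+L = m<n⇒m<1+n (+-monoˡ-< L 2≤i)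
    ... | inj₁ j<L = begin
      g i (suc j)         ≡⟨ g-initial i j<L ⟩
      δ (i + suc j) k     ≡⟨ cong (λ n → δ n k) (+-suc i j) ⟩
      δ (suc i + j) k     ≡⟨ g-initial (suc i) j≤L ⟨
      g (suc i) j         ≡⟨ cong (_+ g (suc i) j) (g₁-leading-zeros j<L) ⟨
      g 1 j + g (suc i) j ∎

  g-window-sum : ∀ d {i} → i + d ≡ suc k → 2 ≤ i →
                 ∀ {j} → d ≤ j → g i j ≡ ∑[ t < d ] g 1 (j ∸ suc t)
  g-window-sum zero {i} i+0≡1+k _ {j} _ =
    trans (cong (λ i → g i j) (trans (sym (+-identityʳ i)) i+0≡1+k)) (g[k+1]≡0 j)
  g-window-sum (suc d) {i} i+1+d≡1+k 2≤i {suc j} (s≤s d≤j) =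
    trans (g-suc-split 2≤i i≤k j) (cong (g 1 j +_) (g-window-sum d 1+i+d≡1+k (m≤n⇒m≤1+n 2≤i) d≤j))
    where
    1+i+d≡1+k : suc i + d ≡ suc k
    1+i+d≡1+k = trans (sym (+-suc i d)) i+1+d≡1+k
    i≤k : i ≤ k
    i≤k = ≤-trans (m≤m+n i d) (≤-reflexive (suc-injective 1+i+d≡1+k))

  -- The first columns of Q_{k,m} and Q^i_{k,n} are (ι^t · columnQ t)_t and (ι^t · columnQi i t)_t.
  columnQ : ℕ → ℕ
  columnQ zero    = c
  columnQ (suc r) = 𝟙[ ⌊ suc r <? k ⌋ ]

  columnQi : ℕ → ℕ → ℕ
  columnQi i t = 𝟙[ ⌊ t ≤? k ∸ i ⌋ ]

  conv-g₁ : ∀ {N} (b : ℕ → ℕ) → (∀ t → N ≤ t → b t ≡ 0) → ∀ m →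
            conv b g₁ m ≡ ∑[ t < N ] (b t * g 1 (m + L ∸ t))
  conv-g₁ {N} b b-vanishes m = begin
    ∑[ t < suc m ] (b t * g 1 (m ∸ t + L))
      ≡⟨ ∑-cong< (suc m) (λ t t≤m → cong (λ n → b t * g 1 n) (sym (+-∸-comm L (s≤s⁻¹ t≤m)))) ⟩
    ∑[ t < suc m ] F t
      ≡⟨ ∑-stable F F-vanishes-above-m (m≤m+n (suc m) N) ⟨
    ∑[ t < suc m + N ] F t
      ≡⟨ ∑-stable F (λ t N≤t → cong (_* _) (b-vanishes t N≤t)) (m≤n+m N (suc m)) ⟩
    ∑[ t < N ] F t
      ∎
    where
    open ≡-Reasoning
    F : ℕ → ℕ
    F t = b t * g 1 (m + L ∸ t)
    F-vanishes-above-m : ∀ t → suc m ≤ t → F t ≡ 0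
    F-vanishes-above-m t m<t =
      trans (cong (b t *_) (g₁-leading-zeros (m<n+o⇒m∸n<o (m + L) t (+-monoˡ-< L m<t)))) (*-zeroʳ (b t))

  g₁-suc-conv : ∀ m → g₁ (suc m) ≡ conv columnQ g₁ m
  g₁-suc-conv m = begin
    g 1 (suc (m + L))              ≡⟨ g-recurrent 1 (m + L) (m≤n+m L m) ⟩
    c * G 0 + ∑[ s < L ] G (suc s) ≡⟨ cong (c * G 0 +_) (∑-weighted-by-1 L (columnQ ∘ suc) (G ∘ suc) below) ⟨
    ∑[ t < k ] (columnQ t * G t)   ≡⟨ conv-g₁ columnQ above m ⟨
    conv columnQ g₁ m              ∎
    where
    open ≡-Reasoning
    G : ℕ → ℕ
    G t = g 1 (m + L ∸ t)
    below : ∀ s → s < L → columnQ (suc s) ≡ 1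
    below s s<L = cong 𝟙[_] (⌊⌋-true (suc s <? k) (s<s s<L))
    above : ∀ t → k ≤ t → columnQ t ≡ 0
    above (suc r) k≤t = cong 𝟙[_] (⌊⌋-false (suc r <? k) (≤⇒≯ k≤t))

  g-suc-conv : ∀ {i} → 2 ≤ i → i ≤ k → ∀ m → g i (suc m + L) ≡ conv (columnQi i) g₁ m
  g-suc-conv {i} 2≤i i≤k m = begin
    g i (suc (m + L))               ≡⟨ g-window-sum d i+d≡1+k 2≤i d≤1+m+L ⟩
    ∑[ t < d ] G t                  ≡⟨ ∑-weighted-by-1 d (columnQi i) G below ⟨
    ∑[ t < d ] (columnQi i t * G t) ≡⟨ conv-g₁ (columnQi i) above m ⟨
    conv (columnQi i) g₁ m          ∎
    where
    open ≡-Reasoning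
    d : ℕ
    d = suc (k ∸ i)
    G : ℕ → ℕ
    G t = g 1 (m + L ∸ t)
    i+d≡1+k : i + d ≡ suc k
    i+d≡1+k = trans (+-suc i (k ∸ i)) (cong suc (m+[n∸m]≡n i≤k))
    d≤1+m+L : d ≤ suc (m + L)
    d≤1+m+L = s≤s (≤-trans (∸-monoʳ-≤ k 2≤i) (≤-trans (n≤1+n ℓ) (m≤n+m L m)))
    below : ∀ t → t < d → columnQi i t ≡ 1
    below t t<d = cong 𝟙[_] (⌊⌋-true (t ≤? k ∸ i) (s≤s⁻¹ t<d))
    above : ∀ t → d ≤ t → columnQi i t ≡ 0
    above t d≤t = cong 𝟙[_] (⌊⌋-false (t ≤? k ∸ i) (<⇒≱ d≤t))

Qentry-suc : ∀ λ' k s t → Qentry λ' k (suc s) (suc t) ≡ Qentry λ' k s t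
Qentry-suc λ' k s t rewrite ≟-suc s t | ≟-suc (suc s) t | <?-suc t s = refl

ΣFin-cong : ∀ {m} {f g : Fin m → ℤ[ι]} → (∀ j → f j ≡ g j) → ΣFin f ≡ ΣFin g
ΣFin-cong {zero}  _   = refl
ΣFin-cong {suc m} f≡g = cong₂ _⊕_ (f≡g zero) (ΣFin-cong (f≡g ∘ suc))

ΣFin-zero : ∀ {m} {f : Fin m → ℤ[ι]} → (∀ j → f j ≡ 𝟘) → ΣFin f ≡ 𝟘
ΣFin-zero {zero}  _   = refl
ΣFin-zero {suc m} f≡0 = cong₂ _⊕_ (f≡0 zero) (ΣFin-zero (f≡0 ∘ suc))

signed-𝟘 : ∀ j → signed j 𝟘 ≡ 𝟘
signed-𝟘 zero          = refl
signed-𝟘 (suc zero)    = refl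
signed-𝟘 (suc (suc j)) = signed-𝟘 j

det-cong : ∀ m {A B : Fin m → Fin m → ℤ[ι]} → (∀ r s → A r s ≡ B r s) → det m A ≡ det m B
det-cong zero    _   = refl
det-cong (suc m) A≡B = ΣFin-cong λ j →
  cong (signed (toℕ j)) (cong₂ _⊗_ (A≡B zero j) (det-cong m (λ r s → A≡B (suc r) (punchIn j s))))

withColumn₀ : ∀ {n} → (ℕ → ℤ[ι]) → (Fin n → Fin n → ℤ[ι]) → Fin n → Fin n → ℤ[ι]
withColumn₀ v A r zero    = v (toℕ r)
withColumn₀ v A r (suc s) = A r (suc s)

column-entry : ∀ b t → (if b then ι^ t else 𝟘) ≡ 𝟙 ⊗ (ι^ t ⊗ fromℕ 𝟙[ b ])
column-entry true  t = sym (trans (⊗-identityˡ _) (⊗-identityʳ (ι^ t)))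
column-entry false t = sym (trans (⊗-identityˡ _) (⊗-zeroʳ (ι^ t)))

module FirstColumnExpansion (λ' : ℤ[ι]) (k : ℕ) where

  det-withColumn₀-expand : ∀ v m →
    det (suc (suc m)) (withColumn₀ v (Q λ' k (suc (suc m))))
      ≡ v 0 ⊗ det (suc m) (Q λ' k (suc m)) ⊕ ⊖ (ι ⊗ det (suc m) (withColumn₀ (v ∘ suc) (Q λ' k (suc m))))
  det-withColumn₀-expand v m =
    cong₂ _⊕_ (cong (v 0 ⊗_) (det-cong (suc m) minor₀))
              (trans (cong₂ _⊕_ (cong (λ d → ⊖ (ι ⊗ d)) (det-cong (suc m) minor₁)) (ΣFin-zero later-columns))
                     (⊕-identityʳ _))
    where
    A = withColumn₀ v (Q λ' k (suc (suc m)))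
    minor₀ : ∀ r s → minor zero A r s ≡ Q λ' k (suc m) r s
    minor₀ r s = Qentry-suc λ' k (toℕ r) (toℕ s)
    minor₁ : ∀ r s → minor (suc zero) A r s ≡ withColumn₀ (v ∘ suc) (Q λ' k (suc m)) r s
    minor₁ r zero    = refl
    minor₁ r (suc s) = Qentry-suc λ' k (toℕ r) (suc (toℕ s))
    later-columns : ∀ j → signed (toℕ j) (A zero (suc (suc j)) ⊗ det (suc m) (minor (suc (suc j)) A)) ≡ 𝟘
    later-columns j =
      trans (cong (signed (toℕ j)) (⊗-zeroˡ (det (suc m) (minor (suc (suc j)) A)))) (signed-𝟘 (toℕ j))

  det-withColumn₀-conv : ∀ m (w : ℤ[ι]) (b q : ℕ → ℕ) {v : ℕ → ℤ[ι]} →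
    (∀ j → v j ≡ w ⊗ (ι^ j ⊗ fromℕ (b j))) →
    (∀ l → l ≤ m → det l (Q λ' k l) ≡ fromℕ (q l)) →
    det (suc m) (withColumn₀ v (Q λ' k (suc m))) ≡ w ⊗ fromℕ (conv b q m)
  det-withColumn₀-conv zero w b q {v} v≡ det≡ = begin
    v 0 ⊗ 𝟙 ⊕ 𝟘
      ≡⟨ cong₂ (λ x y → x ⊗ y ⊕ 𝟘) (v≡ 0) (det≡ 0 z≤n) ⟩
    w ⊗ (𝟙 ⊗ fromℕ (b 0)) ⊗ fromℕ (q 0) ⊕ 𝟘
      ≡⟨ cong (w ⊗ (𝟙 ⊗ fromℕ (b 0)) ⊗ fromℕ (q 0) ⊕_) (⊗-zeroʳ w) ⟨
    w ⊗ (𝟙 ⊗ fromℕ (b 0)) ⊗ fromℕ (q 0) ⊕ w ⊗ 𝟘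
      ≡⟨ ⊗-fromℕ-*-+ w (b 0) (q 0) 0 ⟩
    w ⊗ fromℕ (b 0 * q 0 + 0)
      ∎
    where open ≡-Reasoning
  det-withColumn₀-conv (suc m) w b q {v} v≡ det≡ = begin
    det (suc (suc m)) (withColumn₀ v (Q λ' k (suc (suc m))))
      ≡⟨ det-withColumn₀-expand v m ⟩
    v 0 ⊗ det (suc m) (Q λ' k (suc m)) ⊕ ⊖ (ι ⊗ det (suc m) (withColumn₀ (v ∘ suc) (Q λ' k (suc m))))
      ≡⟨ cong₂ (λ x y → x ⊕ ⊖ (ι ⊗ y)) (cong₂ _⊗_ (v≡ 0) (det≡ (suc m) ≤-refl))
               (det-withColumn₀-conv m (w ⊗ ι) (b ∘ suc) q shifted-column
                                     (λ l l≤m → det≡ l (m≤n⇒m≤1+n l≤m))) ⟩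
    w ⊗ (𝟙 ⊗ fromℕ (b 0)) ⊗ fromℕ (q (suc m)) ⊕ ⊖ (ι ⊗ ((w ⊗ ι) ⊗ fromℕ X))
      ≡⟨ cong (w ⊗ (𝟙 ⊗ fromℕ (b 0)) ⊗ fromℕ (q (suc m)) ⊕_) (ι⊗w⊗ι-neg w (fromℕ X)) ⟩
    w ⊗ (𝟙 ⊗ fromℕ (b 0)) ⊗ fromℕ (q (suc m)) ⊕ w ⊗ fromℕ X
      ≡⟨ ⊗-fromℕ-*-+ w (b 0) (q (suc m)) X ⟩
    w ⊗ fromℕ (b 0 * q (suc m) + X) ∎
    where
    open ≡-Reasoning
    X = conv (b ∘ suc) q m
    shifted-column : ∀ j → v (suc j) ≡ (w ⊗ ι) ⊗ (ι^ j ⊗ fromℕ (b (suc j)))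
    shifted-column j = trans (v≡ (suc j)) (trans (cong (w ⊗_) (⊗-assoc ι (ι^ j) _)) (sym (⊗-assoc w ι _)))

module Determinants (c ℓ : ℕ) where
  open Sequence c ℓ
  open FirstColumnExpansion (fromℕ c) k

  det-Q : ∀ l → det l (Q (fromℕ c) k l) ≡ fromℕ (g₁ l)
  det-Q = <-rec _ det-Q-from-smaller
    where
    open ≡-Reasoning
    det-Q-from-smaller : ∀ l → (∀ {l'} → l' < l → det l' (Q (fromℕ c) k l') ≡ fromℕ (g₁ l')) →
                         det l (Q (fromℕ c) k l) ≡ fromℕ (g₁ l)
    det-Q-from-smaller zero    _       = cong fromℕ (sym (trans (g-initial 1 ≤-refl) (δ-refl k)))
    det-Q-from-smaller (suc m) smaller = begin
      det (suc m) (Q (fromℕ c) k (suc m))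
        ≡⟨ det-cong (suc m) {A = Q (fromℕ c) k (suc m)} {B = withColumn₀ v (Q (fromℕ c) k (suc m))}
                    (λ { r zero → refl ; r (suc _) → refl }) ⟩
      det (suc m) (withColumn₀ v (Q (fromℕ c) k (suc m)))
        ≡⟨ det-withColumn₀-conv m 𝟙 columnQ g₁ column (λ l l≤m → smaller (s≤s l≤m)) ⟩
      𝟙 ⊗ fromℕ (conv columnQ g₁ m) ≡⟨ ⊗-identityˡ _ ⟩
      fromℕ (conv columnQ g₁ m)     ≡⟨ cong fromℕ (g₁-suc-conv m) ⟨
      fromℕ (g₁ (suc m))            ∎
      where
      v : ℕ → ℤ[ι]
      v j = Qentry (fromℕ c) k j 0
      column : ∀ j → v j ≡ 𝟙 ⊗ (ι^ j ⊗ fromℕ (columnQ j))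
      column zero    = sym (trans (⊗-identityˡ _) (⊗-identityˡ _))
      column (suc r) = column-entry ⌊ suc r <? k ⌋ (suc r)

  det-Qi : ∀ {i} → 2 ≤ i → i ≤ k → ∀ m →
           det (suc m) (Qi (fromℕ c) k i (suc m)) ≡ fromℕ (g i (suc m + L))
  det-Qi {i} 2≤i i≤k m = begin
    det (suc m) (Qi (fromℕ c) k i (suc m))
      ≡⟨ det-cong (suc m) Qi≡ ⟩
    det (suc m) (withColumn₀ v (Q (fromℕ c) k (suc m)))
      ≡⟨ det-withColumn₀-conv m 𝟙 (columnQi i) g₁ column (λ l _ → det-Q l) ⟩
    𝟙 ⊗ fromℕ (conv (columnQi i) g₁ m) ≡⟨ ⊗-identityˡ _ ⟩
    fromℕ (conv (columnQi i) g₁ m)     ≡⟨ cong fromℕ (g-suc-conv 2≤i i≤k m) ⟨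
    fromℕ (g i (suc m + L))            ∎
    where
    open ≡-Reasoning
    v : ℕ → ℤ[ι]
    v j = if ⌊ j ≤? k ∸ i ⌋ then ι^ j else 𝟘
    column : ∀ j → v j ≡ 𝟙 ⊗ (ι^ j ⊗ fromℕ (columnQi i j))
    column j = column-entry ⌊ j ≤? k ∸ i ⌋ j
    Qi≡ : ∀ r s → Qi (fromℕ c) k i (suc m) r s ≡ withColumn₀ v (Q (fromℕ c) k (suc m)) r s
    Qi≡ zero    zero          = refl
    Qi≡ zero    (suc zero)    = refl
    Qi≡ zero    (suc (suc _)) = refl
    Qi≡ (suc r) zero          = refl
    Qi≡ (suc r) (suc s)       = sym (Qentry-suc (fromℕ c) k (toℕ r) (toℕ s))

corollary1p13 : (k i n : ℕ) → 2 ≤ k → 2 ≤ i → i ≤ k → 2 ≤ n →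
    (det n (Qi (fromℕ 1) k i n) ≡ fromℕ (fib k i n))
      × (det n (Qi (fromℕ 2) k i n) ≡ fromℕ (pell k i n))
corollary1p13 (suc (suc ℓ)) i (suc m) (s≤s (s≤s _)) 2≤i i≤k _ =
  Determinants.det-Qi 1 ℓ 2≤i i≤k m , Determinants.det-Qi 2 ℓ 2≤i i≤k m
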